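{- In two-player games with objective $\mathrm{LowerBound}(0)\cap\mathrm{AvgEnergy}(t)$: (i) pseudo-polynomial-memory strategies are necessary for player 1, i.e. there are families of such games, with a fixed number of states and weights of absolute value at most a parameter $U$, in which player 1 has a winning strategy but every winning strategy of player 1 needs a number of memory states growing with the value $U$; and (ii) memory is also required for player 2: there exist a game $G$, an initial state $s_{init}$ and $t\in\mathbb{Q}$ such that player 2 has a winning strategy from $s_{init}$ (against $\mathrm{LowerBound}(0)\cap\mathrm{AvgEnergy}(t)$) but no memoryless winning strategy.
   Context: A game is a tuple $G=(S_1,S_2,E,w)$ where $S_1,S_2$ are disjoint finite sets of states (of player 1 and player 2), $S=S_1\uplus S_2$, $E\subseteq S\times S$ is a set of edges with every state having a successor, and $w\colon E\to\mathbb{Z}$. A play from $s_{init}$ is $\pi=s_0s_1\dots$ with $s_0=s_{init}$ and $(s_i,s_{i+1})\in E$; $\pi(n)=s_0\dots s_n$; $\mathrm{EL}(\pi(n))=\sum_{i=0}^{n-1}w(s_i,s_{i+1})$; $\overline{\mathrm{AE}}(\pi)=\limsup_n\frac1n\sum_{i=1}^n\mathrm{EL}(\pi(i))$. A strategy of player $i$ maps each finite prefix ending in $S_i$ to a successor of its last state; it is memoryless if it depends only on the last state, and finite-memory with memory size $|M|$ if implemented by a deterministic Moore machine with finite memory set $M$. Player 1 wins with a strategy from $s_{init}$ for objective $\mathcal{W}$ if all consistent plays lie in $\mathcal{W}$; player 2 wins with a strategy if no consistent play lies in $\mathcal{W}$. $\mathrm{AvgEnergy}(t)=\{\pi\mid\overline{\mathrm{AE}}(\pi)\le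 t\}$; $\mathrm{LowerBound}(c_{init})=\{\pi\mid\forall n\ge0,\ c_{init}+\mathrm{EL}(\pi(n))\ge0\}$. -}

module Defs where

open import Data.Nat as ℕ using (ℕ; zero; suc)
open import Data.Integer as ℤ using (ℤ; ∣_∣)
open import Data.Rational as ℚ using (ℚ; 0ℚ)
open import Data.Fin using (Fin)
open import Data.Bool using (Bool; true)
open import Data.List using (List; []; _∷_)
open import Data.Product using (Σ; ∃; _×_)
open import Data.Empty using (⊥)
open import Relation.Binary.PropositionalEquality using (_≡_)

data Player : Set where
  P1 P2 : Player

-- A game with states Fin n.  owner s = P1 iff s ∈ S₁.
-- edge s s' ≡ true iff (s , s') ∈ E.  weight is only relevant on edges.
record Game (n : ℕ) : Set where
  field
    owner  : Fin n → Player
    edge   : Fin n → Fin n → Bool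
    weight : Fin n → Fin n → ℤ
    total  : ∀ s → ∃ λ s' → edge s s' ≡ true
open Game public

module _ {n : ℕ} (G : Game n) where

  -- A strategy of player p. A finite prefix s₀ … s_k is represented by its
  -- last state s_k together with the list of earlier states in REVERSE order
  -- (s_{k-1} ∷ … ∷ s₀ ∷ []).  Only histories ending in S_p are constrained.
  record Strategy (p : Player) : Set where
    field
      move  : Fin n → List (Fin n) → Fin n
      valid : ∀ s h → owner G s ≡ p → edge G s (move s h) ≡ true
  open Strategy public

  record Play (s₀ : Fin n) : Set where
    field
      path  : ℕ → Fin n
      start : path 0 ≡ s₀
      step  : ∀ i → edge G (path i) (path (suc i)) ≡ true
  open Play public

  past : (ℕ → Fin n) → ℕ → List (Fin n)
  past π zero    = []
  past π (suc i) = π i ∷ past π i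

  Consistent : ∀ {p s₀} → Strategy p → Play s₀ → Set
  Consistent {p} σ π = ∀ i → owner G (path π i) ≡ p →
    path π (suc i) ≡ move σ (path π i) (past (path π) i)

  EL : (ℕ → Fin n) → ℕ → ℤ
  EL π zero    = ℤ.0ℤ
  EL π (suc k) = EL π k ℤ.+ weight G (π k) (π (suc k))

  cumEL : (ℕ → Fin n) → ℕ → ℤ
  cumEL π zero    = ℤ.0ℤ
  cumEL π (suc k) = cumEL π k ℤ.+ EL π (suc k)

  -- (1/k) Σ_{i=1}^{k} EL(π(i)) for k = suc m ≥ 1
  avgEL : (ℕ → Fin n) → ℕ → ℚ
  avgEL π m = cumEL π (suc m) ℚ./ suc m

  -- limsup_k avgEL ≤ t  (standard unfolding of limsup ≤ t)
  AvgEnergy : ∀ {s₀} → ℚ → Play s₀ → Set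
  AvgEnergy t π = ∀ (ε : ℚ) → 0ℚ ℚ.< ε →
    ∃ λ N → ∀ m → N ℕ.≤ m → avgEL (path π) m ℚ.≤ t ℚ.+ ε

  LowerBound : ∀ {s₀} → ℤ → Play s₀ → Set
  LowerBound c π = ∀ k → ℤ.0ℤ ℤ.≤ c ℤ.+ EL (path π) k

  Objective : ∀ {s₀} → ℚ → Play s₀ → Set
  Objective t π = LowerBound ℤ.0ℤ π × AvgEnergy t π

  Wins₁ : Fin n → ℚ → Strategy P1 → Set
  Wins₁ s₀ t σ = (π : Play s₀) → Consistent σ π → Objective t π

  Wins₂ : Fin n → ℚ → Strategy P2 → Set
  Wins₂ s₀ t τ = (π : Play s₀) → Consistent τ π → Objective t π → ⊥

  Memoryless : ∀ {p} → Strategy p → Set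
  Memoryless {p} σ = ∀ s h h' → owner G s ≡ p → move σ s h ≡ move σ s h'

  memRead : {m : ℕ} → Fin m → (Fin m → Fin n → Fin m) → List (Fin n) → Fin m
  memRead m₀ up []      = m₀
  memRead m₀ up (x ∷ h) = up (memRead m₀ up h) x

  -- σ is implemented by a Moore machine with memory set Fin m:
  -- initial memory m₀, update up, next-move function nxt;
  -- on prefix s₀…s_k the memory is up(…up(m₀,s₀)…,s_k) and the move is nxt(mem, s_k).
  HasMemory : ∀ {p} → Strategy p → ℕ → Set
  HasMemory {p} σ m =
    Σ (Fin m) λ m₀ → Σ (Fin m → Fin n → Fin m) λ up → Σ (Fin m → Fin n → Fin n) λ nxt →
      ∀ s h → owner G s ≡ p → move σ s h ≡ nxt (up (memRead m₀ up h) s) s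

-- (i) In climbGame U player 1 starts at energy 0 on a self-loop of weight 1, next to an edge of
-- weight -U into a sink of weight 0. Leaving after exactly U rounds keeps the energy in [0, U], so
-- the average energy is at most U. Leaving earlier breaks the lower bound, and a Moore machine with
-- fewer than U memory states repeats a (memory, state) configuration during those first rounds on
-- the loop, hence never leaves it; then the energy grows linearly and its average diverges.
-- (ii) In judgeGame player 1 repeatedly chooses between gaining 1 and gaining nothing, after which
-- player 2 either returns or jumps into a sink through an edge of weight -1. Punishing exactly the
-- plays that never gained wins for player 2: such a play drops below 0 at once, and otherwise the
-- energy stays at least 1, so its average exceeds 1/2. A memoryless player 2 either always returns,
-- and player 1 idles at energy 0 forever, or always punishes, and player 1 gains once and then sits
-- in the sink, where the average energy tends to 0.
module Submission where

open import Defs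
open import Data.Nat using (ℕ; zero; suc; _+_; _*_; _∸_; _⊓_; _≤_; _<_; z≤n; s≤s; _≤?_; _<?_)
import Data.Nat.Properties as ℕP
open import Data.Nat.Induction using (<-rec)
open import Data.Nat.Tactic.RingSolver using (solve-∀)
open import Data.Integer as ℤ using (ℤ; +_; -[1+_]; 0ℤ; +≤+; ∣_∣)
import Data.Integer.Properties as ℤP
open import Data.Rational as ℚ using (ℚ; _/_; 0ℚ; 1ℚ)
open import Data.Rational.Unnormalised as ℚᵘ using (mkℚᵘ; *≤*)
import Data.Rational.Properties as ℚP
import Data.Rational.Unnormalised.Properties as ℚᵘP
open import Data.Fin using (Fin; zero; suc; toℕ)
import Data.Fin.Properties as FinP
open import Data.Bool using (Bool; true; false; if_then_else_)
open import Data.List using (List; []; _∷_; length)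
open import Data.List.Membership.Propositional using (_∈_)
open import Data.List.Membership.DecPropositional (FinP._≟_ {5}) using (_∈?_)
open import Data.List.Relation.Unary.Any using (here; there)
open import Data.Product using (Σ; ∃; ∃₂; _×_; _,_; proj₁; proj₂)
open import Data.Sum using (_⊎_; inj₁; inj₂)
open import Data.Empty using (⊥-elim)
open import Relation.Nullary using (¬_; does; yes; no)
open import Relation.Nullary.Decidable using (dec-true; dec-false)
open import Relation.Binary.PropositionalEquality
  using (_≡_; _≢_; refl; sym; trans; cong; cong₂; subst; subst₂; module ≡-Reasoning)

toℚᵘ-/suc : ∀ i m → ℚ.toℚᵘ (i / suc m) ℚᵘ.≃ mkℚᵘ i m
toℚᵘ-/suc i m = ℚP.toℚᵘ-fromℚᵘ (mkℚᵘ i m)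

cross-≤⇒/≤ : ∀ a b m k → a * suc k ≤ b * suc m → + a / suc m ℚ.≤ + b / suc k
cross-≤⇒/≤ a b m k ak≤bm = ℚP.toℚᵘ-cancel-≤
  (ℚᵘP.≤-respˡ-≃ (ℚᵘP.≃-sym (toℚᵘ-/suc (+ a) m)) (ℚᵘP.≤-respʳ-≃ (ℚᵘP.≃-sym (toℚᵘ-/suc (+ b) k))
    (*≤* (subst₂ ℤ._≤_ (ℤP.pos-* a (suc k)) (ℤP.pos-* b (suc m)) (+≤+ ak≤bm)))))

/≤⇒cross-≤ : ∀ a b m k → + a / suc m ℚ.≤ + b / suc k → a * suc k ≤ b * suc m
/≤⇒cross-≤ a b m k a/m≤b/k with subst₂ ℤ._≤_ (sym (ℤP.pos-* a (suc k))) (sym (ℤP.pos-* b (suc m)))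
  (ℚᵘP.drop-*≤* (ℚᵘP.≤-respˡ-≃ (toℚᵘ-/suc (+ a) m) (ℚᵘP.≤-respʳ-≃ (toℚᵘ-/suc (+ b) k)
    (ℚP.toℚᵘ-mono-≤ a/m≤b/k))))
... | +≤+ ak≤bm = ak≤bm

+/1+1ℚ : ∀ K → + K / 1 ℚ.+ 1ℚ ≡ + suc K / 1
+/1+1ℚ K = ℚP.toℚᵘ-injective
  (ℚᵘP.≃-trans (ℚP.toℚᵘ-homo-+ (+ K / 1) 1ℚ)
  (ℚᵘP.≃-trans (ℚᵘP.+-congˡ (mkℚᵘ (+ 1) 0) (toℚᵘ-/suc (+ K) 0))
  (ℚᵘP.≃-trans (ℚᵘP.≃-reflexive (cong (λ z → mkℚᵘ z 0) numerator))
  (ℚᵘP.≃-sym (toℚᵘ-/suc (+ suc K) 0)))))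
  where
  numerator : + K ℤ.* + 1 ℤ.+ + 1 ℤ.* + 1 ≡ + suc K
  numerator = trans (cong (ℤ._+ + 1) (ℤP.*-identityʳ (+ K))) (cong +_ (ℕP.+-comm K 1))

triangle : ℕ → ℕ
triangle zero    = 0
triangle (suc k) = triangle k + suc k

2*triangle : ∀ k → 2 * triangle k ≡ k * suc k
2*triangle zero    = refl
2*triangle (suc k) = begin
  2 * (triangle k + suc k)    ≡⟨ ℕP.*-distribˡ-+ 2 (triangle k) (suc k) ⟩
  2 * triangle k + 2 * suc k  ≡⟨ cong (_+ 2 * suc k) (2*triangle k) ⟩
  k * suc k + 2 * suc k       ≡⟨ normalise k ⟩
  suc k * suc (suc k)         ∎
  where
  open ≡-Reasoning
  normalise : ∀ k → k * suc k + 2 * suc k ≡ suc k * suc (suc k)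
  normalise = solve-∀

iterate-periodic : ∀ {A : Set} (f : A → A) (x : ℕ → A) → (∀ k → x (suc k) ≡ f (x k)) →
                   ∀ {i j} → x i ≡ x j → ∀ d → x (d + i) ≡ x (d + j)
iterate-periodic f x x-suc xi≡xj zero    = xi≡xj
iterate-periodic f x x-suc {i} {j} xi≡xj (suc d) =
  trans (x-suc (d + i)) (trans (cong f (iterate-periodic f x x-suc xi≡xj d)) (sym (x-suc (d + j))))

repeating-constant : ∀ {A : Set} (x : ℕ → A) {a i j m} → i < j → j ≤ m →
                     (∀ d → x (d + i) ≡ x (d + j)) → (∀ k → k ≤ m → x k ≡ a) → ∀ k → x k ≡ a
repeating-constant x {a} {i} {j} {m} i<j j≤m periodic x≤m≡a = <-rec _ constant
  where
  constant : ∀ k → (∀ {k′} → k′ < k → x k′ ≡ a) → x k ≡ a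
  constant k rec with k ≤? m
  ... | yes k≤m = x≤m≡a k k≤m
  ... | no k≰m = begin
    x k             ≡⟨ cong x (sym (ℕP.m∸n+n≡m j≤k)) ⟩
    x (k ∸ j + j)   ≡⟨ sym (periodic (k ∸ j)) ⟩
    x (k ∸ j + i)   ≡⟨ rec (subst (k ∸ j + i <_) (ℕP.m∸n+n≡m j≤k) (ℕP.+-monoʳ-< (k ∸ j) i<j)) ⟩
    a               ∎
    where
    open ≡-Reasoning
    j≤k : j ≤ k
    j≤k = ℕP.≤-trans j≤m (ℕP.<⇒≤ (ℕP.≰⇒> k≰m))

length-past : ∀ {n} (G : Game n) (π : ℕ → Fin n) i → length (past G π i) ≡ i
length-past G π zero    = refl
length-past G π (suc i) = cong suc (length-past G π i)

module _ {n : ℕ} (G : Game n) {s₀ : Fin n} (π : Play G s₀) where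

  LowerBound-of-EL≥0 : (∀ k → 0ℤ ℤ.≤ EL G (path π) k) → LowerBound G 0ℤ π
  LowerBound-of-EL≥0 EL≥0 k = subst (0ℤ ℤ.≤_) (sym (ℤP.+-identityˡ _)) (EL≥0 k)

  AvgEnergy-of-avgEL≤ : ∀ {t} N → (∀ m → N ≤ m → avgEL G (path π) m ℚ.≤ t) → AvgEnergy G t π
  AvgEnergy-of-avgEL≤ {t} N avg≤ ε ε>0 = N , λ m N≤m → ℚP.≤-trans (avg≤ m N≤m) t≤t+ε
    where
    t≤t+ε : t ℚ.≤ t ℚ.+ ε
    t≤t+ε = subst (ℚ._≤ t ℚ.+ ε) (ℚP.+-identityʳ t) (ℚP.+-monoʳ-≤ t (ℚP.<⇒≤ ε>0))

  AvgEnergy-mono : ∀ {t t′} → t ℚ.≤ t′ → AvgEnergy G t π → AvgEnergy G t′ π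
  AvgEnergy-mono t≤t′ ae ε ε>0 with ae ε ε>0
  ... | N , avg≤ = N , λ m N≤m → ℚP.≤-trans (avg≤ m N≤m) (ℚP.+-monoˡ-≤ ε t≤t′)

  AvgEnergy⇒avgEL≤ : ∀ {t ε} → AvgEnergy G t π → 0ℚ ℚ.< ε →
                     ∀ N₀ → ∃ λ m → N₀ ≤ m × avgEL G (path π) m ℚ.≤ t ℚ.+ ε
  AvgEnergy⇒avgEL≤ {ε = ε} ae ε>0 N₀ with ae ε ε>0
  ... | N , avg≤ = N₀ + N , ℕP.m≤m+n N₀ N , avg≤ (N₀ + N) (ℕP.m≤n+m N N₀)

  cumEL-bounded : ∀ K → (∀ i → ∃ λ e → EL G (path π) i ≡ + e × e ≤ K) →
                  ∀ m → ∃ λ c → cumEL G (path π) m ≡ + c × c ≤ m * K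
  cumEL-bounded K EL≤ zero = 0 , refl , z≤n
  cumEL-bounded K EL≤ (suc m) with cumEL-bounded K EL≤ m | EL≤ (suc m)
  ... | c , cum≡c , c≤mK | e , EL≡e , e≤K =
    c + e , cong₂ ℤ._+_ cum≡c EL≡e , subst (c + e ≤_) (ℕP.+-comm (m * K) K) (ℕP.+-mono-≤ c≤mK e≤K)

  Objective-of-0≤EL≤ : ∀ K → (∀ i → ∃ λ e → EL G (path π) i ≡ + e × e ≤ K) → Objective G (+ K / 1) π
  Objective-of-0≤EL≤ K EL≤ = LowerBound-of-EL≥0 EL≥0 , AvgEnergy-of-avgEL≤ 0 (λ m _ → avg≤ m)
    where
    EL≥0 : ∀ k → 0ℤ ℤ.≤ EL G (path π) k
    EL≥0 k with EL≤ k
    ... | e , EL≡e , _ = subst (0ℤ ℤ.≤_) (sym EL≡e) (+≤+ z≤n)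
    avg≤ : ∀ m → avgEL G (path π) m ℚ.≤ + K / 1
    avg≤ m with cumEL-bounded K EL≤ (suc m)
    ... | c , cum≡c , c≤ = subst (λ z → z / suc m ℚ.≤ + K / 1) (sym cum≡c)
      (cross-≤⇒/≤ c K m 0 (subst₂ _≤_ (sym (ℕP.*-identityʳ c)) (ℕP.*-comm (suc m) K) c≤))

  ¬AvgEnergy-½-of-EL≥1 : (∀ k → + 1 ℤ.≤ EL G (path π) (suc k)) → ¬ AvgEnergy G (+ 1 / 2) π
  ¬AvgEnergy-½-of-EL≥1 EL≥1 ae
    with AvgEnergy⇒avgEL≤ {t = + 1 / 2} {ε = + 1 / 4} ae (ℚ.*<* (ℤ.+<+ (s≤s z≤n))) 0
  ... | m , _ , avg≤ = 4≰3 (ℕP.*-cancelʳ-≤ 4 3 (suc m) (begin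
      4 * suc m  ≡⟨ ℕP.*-comm 4 (suc m) ⟩
      suc m * 4  ≤⟨ ℕP.*-monoˡ-≤ 4 m<a ⟩
      a * 4      ≤⟨ /≤⇒cross-≤ a 3 m 3 (subst (λ z → z / suc m ℚ.≤ + 3 / 4) cum≡a avg≤) ⟩
      3 * suc m  ∎))
    where
    open ℕP.≤-Reasoning
    cum≥ : ∀ k → + k ℤ.≤ cumEL G (path π) k
    cum≥ zero    = +≤+ z≤n
    cum≥ (suc k) = subst (ℤ._≤ cumEL G (path π) (suc k)) (cong +_ (ℕP.+-comm k 1))
                     (ℤP.+-mono-≤ (cum≥ k) (EL≥1 k))
    a : ℕ
    a = ∣ cumEL G (path π) (suc m) ∣
    cum≡a : cumEL G (path π) (suc m) ≡ + a
    cum≡a = sym (ℤP.0≤i⇒+∣i∣≡i (ℤP.≤-trans (+≤+ z≤n) (cum≥ (suc m))))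
    m<a : suc m ≤ a
    m<a with subst (+ suc m ℤ.≤_) cum≡a (cum≥ (suc m))
    ... | +≤+ m<a = m<a
    4≰3 : ¬ 4 ≤ 3
    4≰3 (s≤s (s≤s (s≤s ())))

  ¬AvgEnergy-of-EL≡id : ∀ K → (∀ k → EL G (path π) k ≡ + k) → ¬ AvgEnergy G (+ K / 1) π
  ¬AvgEnergy-of-EL≡id K EL≡k ae
    with AvgEnergy⇒avgEL≤ {t = + K / 1} {ε = 1ℚ} ae (ℚ.*<* (ℤ.+<+ (s≤s z≤n))) (2 * suc K)
  ... | m , 2[K+1]≤m , avg≤ = ℕP.<⇒≱ (s≤s (ℕP.m≤n⇒m≤1+n 2[K+1]≤m))
        (ℕP.*-cancelʳ-≤ (suc (suc m)) (2 * suc K) (suc m) (begin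
          suc (suc m) * suc m        ≡⟨ ℕP.*-comm (suc (suc m)) (suc m) ⟩
          suc m * suc (suc m)        ≡⟨ sym (2*triangle (suc m)) ⟩
          2 * triangle (suc m)       ≡⟨ cong (2 *_) (sym (ℕP.*-identityʳ (triangle (suc m)))) ⟩
          2 * (triangle (suc m) * 1) ≤⟨ ℕP.*-monoʳ-≤ 2 triangle≤ ⟩
          2 * (suc K * suc m)        ≡⟨ sym (ℕP.*-assoc 2 (suc K) (suc m)) ⟩
          2 * suc K * suc m          ∎))
    where
    open ℕP.≤-Reasoning
    cum≡ : ∀ k → cumEL G (path π) k ≡ + triangle k
    cum≡ zero    = refl
    cum≡ (suc k) = cong₂ ℤ._+_ (cum≡ k) (EL≡k (suc k))
    triangle≤ : triangle (suc m) * 1 ≤ suc K * suc m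
    triangle≤ = /≤⇒cross-≤ (triangle (suc m)) (suc K) m 0
      (subst₂ (λ x y → x / suc m ℚ.≤ y) (cum≡ (suc m)) (+/1+1ℚ K) avg≤)

module Outcome {n : ℕ} (G : Game n) (solo : ∀ s → owner G s ≡ P1) (σ : Strategy G P1) (s₀ : Fin n) where

  history : ℕ → Fin n × List (Fin n)
  history zero    = s₀ , []
  history (suc i) = move σ (proj₁ (history i)) (proj₂ (history i)) , proj₁ (history i) ∷ proj₂ (history i)

  outcome : Play G s₀
  outcome = record
    { path  = λ i → proj₁ (history i)
    ; start = refl
    ; step  = λ i → valid σ (proj₁ (history i)) (proj₂ (history i)) (solo _)
    }

  past-outcome : ∀ i → past G (path outcome) i ≡ proj₂ (history i)
  past-outcome zero    = refl
  past-outcome (suc i) = cong (path outcome i ∷_) (past-outcome i)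

  outcome-consistent : Consistent G σ outcome
  outcome-consistent i _ = cong (move σ (path outcome i)) (sym (past-outcome i))

  outcome-stays : ∀ {m} → HasMemory G σ m → ∀ {a} →
                  (∀ i → i ≤ m → path outcome i ≡ a) → ∀ k → path outcome k ≡ a
  outcome-stays {m} (m₀ , update , next , move≡) {a} stays≤m =
    repeating-constant P i<j j≤m (λ d → cong proj₂ (periodic d)) stays≤m
    where
    P : ℕ → Fin n
    P = path outcome
    memory : ℕ → Fin m
    memory k = memRead G m₀ update (past G P k)
    configuration : ℕ → Fin m × Fin n
    configuration k = memory (suc k) , P k
    transition : Fin m × Fin n → Fin m × Fin n
    transition (μ , s) = update μ (next μ s) , next μ s
    P-suc : ∀ k → P (suc k) ≡ next (memory (suc k)) (P k)
    P-suc k = trans (move≡ (P k) (proj₂ (history k)) (solo _))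
      (cong (λ h → next (update (memRead G m₀ update h) (P k)) (P k)) (sym (past-outcome k)))
    configuration-suc : ∀ k → configuration (suc k) ≡ transition (configuration k)
    configuration-suc k = cong (λ s → update (memory (suc k)) s , s) (P-suc k)
    -- pigeonhole: m memory states at the m + 1 times 0, …, m, all spent in state a
    repeat : ∃₂ λ (i j : Fin (suc m)) → toℕ i < toℕ j × memory (suc (toℕ i)) ≡ memory (suc (toℕ j))
    repeat = FinP.pigeonhole (ℕP.n<1+n m) (λ i → memory (suc (toℕ i)))
    i j : ℕ
    i = toℕ (proj₁ repeat)
    j = toℕ (proj₁ (proj₂ repeat))
    i<j : i < j
    i<j = proj₁ (proj₂ (proj₂ repeat))
    j≤m : j ≤ m
    j≤m = ℕP.≤-pred (FinP.toℕ<n (proj₁ (proj₂ repeat)))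
    periodic : ∀ d → configuration (d + i) ≡ configuration (d + j)
    periodic = iterate-periodic transition configuration configuration-suc
      (cong₂ _,_ (proj₂ (proj₂ (proj₂ repeat)))
        (trans (stays≤m i (ℕP.<⇒≤ (ℕP.<-≤-trans i<j j≤m))) (sym (stays≤m j j≤m))))

pattern home = zero
pattern exit = suc zero

climbEdge : Fin 2 → Fin 2 → Bool
climbEdge home _    = true
climbEdge exit home = false
climbEdge exit exit = true

-- The loop weight 1 ⊓ U is 1 except for U = 0, where it keeps all weights within the bound U.
climbWeight : ℕ → Fin 2 → Fin 2 → ℤ
climbWeight U home home = + (1 ⊓ U)
climbWeight U home exit = ℤ.- (+ U)
climbWeight U exit _    = 0ℤ

climbGame : ℕ → Game 2
climbGame U = record
  { owner  = λ _ → P1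
  ; edge   = climbEdge
  ; weight = climbWeight U
  ; total  = λ { home → home , refl ; exit → exit , refl }
  }

climbWeight-bounded : ∀ U x y → climbEdge x y ≡ true → ∣ climbWeight U x y ∣ ≤ U
climbWeight-bounded U home home _ = ℕP.m⊓n≤n 1 U
climbWeight-bounded U home exit _ = ℕP.≤-reflexive (ℤP.∣-i∣≡∣i∣ (+ U))
climbWeight-bounded U exit exit _ = z≤n

climbChoice : ℕ → ℕ → Fin 2
climbChoice U i = if does (i <? U) then home else exit

climbMove : ℕ → Fin 2 → List (Fin 2) → Fin 2
climbMove U home h = climbChoice U (length h)
climbMove U exit _ = exit

climbThenExit : ∀ U → Strategy (climbGame U) P1
climbThenExit U = record { move = climbMove U ; valid = λ { home _ _ → refl ; exit _ _ → refl } }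

EL-while-home : ∀ {U} (P : ℕ → Fin 2) → 0 < U →
                ∀ i → (∀ k → k ≤ i → P k ≡ home) → EL (climbGame U) P i ≡ + i
EL-while-home P U>0 zero _ = refl
EL-while-home {suc U} P U>0 (suc i) home≤ = begin
  EL (climbGame (suc U)) P i ℤ.+ climbWeight (suc U) (P i) (P (suc i))
    ≡⟨ cong₂ ℤ._+_ (EL-while-home P U>0 i (λ k k≤i → home≤ k (ℕP.m≤n⇒m≤1+n k≤i)))
                   (cong₂ (climbWeight (suc U)) (home≤ i (ℕP.n≤1+n i)) (home≤ (suc i) ℕP.≤-refl)) ⟩
  + i ℤ.+ + 1
    ≡⟨ cong +_ (ℕP.+-comm i 1) ⟩
  + suc i ∎
  where open ≡-Reasoning

home-until-U : ∀ {U} (π : Play (climbGame U) home) → LowerBound (climbGame U) 0ℤ π →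
               ∀ i → i ≤ U → ∀ k → k ≤ i → path π k ≡ home
home-until-U π lb zero _ zero _ = start π
home-until-U {U} π lb (suc i) i<U k k≤1+i with ℕP.m≤n⇒m<n∨m≡n k≤1+i
... | inj₁ k<1+i = home-until-U π lb i (ℕP.<⇒≤ i<U) k (ℕP.≤-pred k<1+i)
... | inj₂ refl with path π (suc i) in P[1+i]
...   | home = refl
...   | exit = ⊥-elim (ℕP.<⇒≱ i<U (U≤i (ℤP.0≤i-j⇒j≤i (subst (0ℤ ℤ.≤_) EL[1+i] (lb (suc i))))))
  where
  home≤i : ∀ k → k ≤ i → path π k ≡ home
  home≤i = home-until-U π lb i (ℕP.<⇒≤ i<U)
  EL[1+i] : 0ℤ ℤ.+ EL (climbGame U) (path π) (suc i) ≡ + i ℤ.- + U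
  EL[1+i] = trans (ℤP.+-identityˡ _)
    (cong₂ ℤ._+_ (EL-while-home (path π) (ℕP.<-≤-trans (s≤s z≤n) i<U) i home≤i)
                 (cong₂ (climbWeight U) (home≤i i ℕP.≤-refl) P[1+i]))
  U≤i : + U ℤ.≤ + i → U ≤ i
  U≤i (+≤+ U≤i) = U≤i

module _ (U : ℕ) {π : Play (climbGame U) home} (cons : Consistent (climbGame U) (climbThenExit U) π) where

  climbMove-home : ∀ i → path π i ≡ home → path π (suc i) ≡ climbChoice U i
  climbMove-home i P[i] = begin
    path π (suc i)                  ≡⟨ cons i refl ⟩
    climbMove U (path π i) earlier  ≡⟨ cong (λ s → climbMove U s earlier) P[i] ⟩
    climbMove U home earlier        ≡⟨ cong (climbChoice U) (length-past (climbGame U) (path π) i) ⟩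
    climbChoice U i                 ∎
    where
    open ≡-Reasoning
    earlier : List (Fin 2)
    earlier = past (climbGame U) (path π) i

  climb-home : ∀ i → i ≤ U → path π i ≡ home
  climb-home zero    _   = start π
  climb-home (suc i) i<U = trans (climbMove-home i (climb-home i (ℕP.<⇒≤ i<U)))
    (cong (λ b → if b then home else exit) (dec-true (i <? U) i<U))

  climb-exit : ∀ i → U < i → path π i ≡ exit
  climb-exit (suc i) U<1+i with ℕP.m≤n⇒m<n∨m≡n (ℕP.≤-pred U<1+i)
  ... | inj₁ U<i = trans (cons i refl)
    (cong (λ s → climbMove U s (past (climbGame U) (path π) i)) (climb-exit i U<i))
  ... | inj₂ refl = trans (climbMove-home U (climb-home U ℕP.≤-refl))
    (cong (λ b → if b then home else exit) (dec-false (U <? U) (ℕP.<-irrefl refl)))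

  climb-EL-≤ : ∀ i → i ≤ U → EL (climbGame U) (path π) i ≡ + i
  climb-EL-≤ zero    _   = refl
  climb-EL-≤ (suc i) i<U = EL-while-home (path π) (ℕP.<-≤-trans (s≤s z≤n) i<U) (suc i)
    (λ k k≤1+i → climb-home k (ℕP.≤-trans k≤1+i i<U))

  climb-EL-> : ∀ i → U < i → EL (climbGame U) (path π) i ≡ 0ℤ
  climb-EL-> (suc i) U<1+i with ℕP.m≤n⇒m<n∨m≡n (ℕP.≤-pred U<1+i)
  ... | inj₁ U<i = cong₂ ℤ._+_ (climb-EL-> i U<i)
    (cong₂ (climbWeight U) (climb-exit i U<i) (climb-exit (suc i) (ℕP.m<n⇒m<1+n U<i)))
  ... | inj₂ refl = trans (cong₂ ℤ._+_ (climb-EL-≤ U ℕP.≤-refl)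
    (cong₂ (climbWeight U) (climb-home U ℕP.≤-refl) (climb-exit (suc U) ℕP.≤-refl))) (ℤP.+-inverseʳ (+ U))

  climb-EL-between : ∀ i → ∃ λ e → EL (climbGame U) (path π) i ≡ + e × e ≤ U
  climb-EL-between i with ℕP.≤-<-connex i U
  ... | inj₁ i≤U = i , climb-EL-≤ i i≤U , i≤U
  ... | inj₂ U<i = 0 , climb-EL-> i U<i , z≤n

climbThenExit-wins : ∀ U → Wins₁ (climbGame U) home (+ U / 1) (climbThenExit U)
climbThenExit-wins U π cons = Objective-of-0≤EL≤ (climbGame U) π U (climb-EL-between U {π} cons)

climb-needs-memory : ∀ {m U} → m < U → ∀ σ → Wins₁ (climbGame U) home (+ U / 1) σ →
                     ¬ HasMemory (climbGame U) σ m
climb-needs-memory {m} {U} m<U σ wins mem =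
  ¬AvgEnergy-of-EL≡id (climbGame U) outcome U EL≡k (proj₂ objective)
  where
  open Outcome (climbGame U) (λ _ → refl) σ home
  objective : Objective (climbGame U) (+ U / 1) outcome
  objective = wins outcome outcome-consistent
  always-home : ∀ k → path outcome k ≡ home
  always-home = outcome-stays mem (home-until-U outcome (proj₁ objective) m (ℕP.<⇒≤ m<U))
  EL≡k : ∀ k → EL (climbGame U) (path outcome) k ≡ + k
  EL≡k k = EL-while-home (path outcome) (ℕP.≤-<-trans z≤n m<U) k (λ k _ → always-home k)

pattern pick  = zero
pattern gain  = suc zero
pattern idle  = suc (suc zero)
pattern judge = suc (suc (suc zero))
pattern sink  = suc (suc (suc (suc zero)))

judgeOwner : Fin 5 → Player
judgeOwner judge = P2
judgeOwner _     = P1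

judgeEdge : Fin 5 → Fin 5 → Bool
judgeEdge pick  gain  = true
judgeEdge pick  idle  = true
judgeEdge gain  judge = true
judgeEdge idle  judge = true
judgeEdge judge pick  = true
judgeEdge judge sink  = true
judgeEdge sink  sink  = true
judgeEdge _     _     = false

judgeWeight : Fin 5 → Fin 5 → ℤ
judgeWeight pick  gain = + 1
judgeWeight judge sink = -[1+ 0 ]
judgeWeight _     _    = 0ℤ

idleNext : Fin 5 → Fin 5
idleNext pick  = idle
idleNext gain  = judge
idleNext idle  = judge
idleNext judge = pick
idleNext sink  = sink

idleNext-edge : ∀ s → judgeEdge s (idleNext s) ≡ true
idleNext-edge pick  = refl
idleNext-edge gain  = refl
idleNext-edge idle  = refl
idleNext-edge judge = refl
idleNext-edge sink  = refl

judgeGame : Game 5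
judgeGame = record
  { owner  = judgeOwner
  ; edge   = judgeEdge
  ; weight = judgeWeight
  ; total  = λ s → idleNext s , idleNext-edge s
  }

judge-only : ∀ s → judgeOwner s ≡ P2 → s ≡ judge
judge-only judge _ = refl

after-pick : ∀ s → judgeEdge pick s ≡ true → s ≡ gain ⊎ s ≡ idle
after-pick gain _ = inj₁ refl
after-pick idle _ = inj₂ refl

after-idle : ∀ s → judgeEdge idle s ≡ true → s ≡ judge
after-idle judge _ = refl

before-sink : ∀ s → judgeEdge s sink ≡ true → s ≡ judge ⊎ s ≡ sink
before-sink judge _ = inj₁ refl
before-sink sink  _ = inj₂ refl

judgeWeight-nonneg : ∀ s s′ → s′ ≢ sink → 0ℤ ℤ.≤ judgeWeight s s′
judgeWeight-nonneg judge sink  s′≢sink = ⊥-elim (s′≢sink refl)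
judgeWeight-nonneg pick  gain  _ = +≤+ z≤n
judgeWeight-nonneg pick  pick  _ = +≤+ z≤n
judgeWeight-nonneg pick  idle  _ = +≤+ z≤n
judgeWeight-nonneg pick  judge _ = +≤+ z≤n
judgeWeight-nonneg pick  sink  _ = +≤+ z≤n
judgeWeight-nonneg judge pick  _ = +≤+ z≤n
judgeWeight-nonneg judge gain  _ = +≤+ z≤n
judgeWeight-nonneg judge idle  _ = +≤+ z≤n
judgeWeight-nonneg judge judge _ = +≤+ z≤n
judgeWeight-nonneg gain  _     _ = +≤+ z≤n
judgeWeight-nonneg idle  _     _ = +≤+ z≤n
judgeWeight-nonneg sink  _     _ = +≤+ z≤n

punishMove : Fin 5 → List (Fin 5) → Fin 5
punishMove _ h = if does (gain ∈? h) then pick else sink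

punishIdle : Strategy judgeGame P2
punishIdle = record { move = punishMove ; valid = valid′ }
  where
  valid′ : ∀ s h → judgeOwner s ≡ P2 → judgeEdge s (punishMove s h) ≡ true
  valid′ s h owner≡P2 with judge-only s owner≡P2 | does (gain ∈? h)
  ... | refl | true  = refl
  ... | refl | false = refl

module _ {π : Play judgeGame pick} (cons : Consistent judgeGame punishIdle π) where

  idle-breaks-LowerBound : path π 1 ≡ idle → ¬ LowerBound judgeGame 0ℤ π
  idle-breaks-LowerBound P[1] lb = negative (path π 0) (path π 1) (path π 2) (path π 3)
    (start π) P[1] P[2] P[3] (lb 3)
    where
    P[2] : path π 2 ≡ judge
    P[2] = after-idle (path π 2) (subst (λ q → judgeEdge q (path π 2) ≡ true) P[1] (step π 1))
    P[3] : path π 3 ≡ sink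
    P[3] = trans (cons 2 (cong judgeOwner P[2]))
      (cong₂ (λ s₁ s₀ → punishMove judge (s₁ ∷ s₀ ∷ [])) P[1] (start π))
    negative : ∀ s₀ s₁ s₂ s₃ → s₀ ≡ pick → s₁ ≡ idle → s₂ ≡ judge → s₃ ≡ sink →
      ¬ 0ℤ ℤ.≤ 0ℤ ℤ.+ (((0ℤ ℤ.+ judgeWeight s₀ s₁) ℤ.+ judgeWeight s₁ s₂) ℤ.+ judgeWeight s₂ s₃)
    negative .pick .idle .judge .sink refl refl refl refl ()

  module _ (P[1] : path π 1 ≡ gain) where

    gain-in-past : ∀ d → gain ∈ past judgeGame (path π) (suc (suc d))
    gain-in-past zero    = here (sym P[1])
    gain-in-past (suc d) = there (gain-in-past d)

    judge-returns : ∀ d → path π (suc d) ≡ judge → path π (suc (suc d)) ≡ pick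
    judge-returns zero P[1]≡judge with trans (sym P[1]) P[1]≡judge
    ... | ()
    judge-returns (suc d) P≡judge = trans (cons (suc (suc d)) (cong judgeOwner P≡judge))
      (cong (λ b → if b then pick else sink) (dec-true (gain ∈? _) (gain-in-past d)))

    never-sink : ∀ d → path π (suc d) ≢ sink
    never-sink zero    P≡sink with trans (sym P[1]) P≡sink
    ... | ()
    never-sink (suc d) P≡sink
      with before-sink (path π (suc d)) (subst (λ s → judgeEdge (path π (suc d)) s ≡ true) P≡sink (step π (suc d)))
    ... | inj₂ P≡sink′ = never-sink d P≡sink′
    ... | inj₁ P≡judge with trans (sym (judge-returns d P≡judge)) P≡sink
    ...   | ()

    EL≥1 : ∀ d → + 1 ℤ.≤ EL judgeGame (path π) (suc d)
    EL≥1 zero    = subst (λ s → + 1 ℤ.≤ 0ℤ ℤ.+ judgeWeight s (path π 1)) (sym (start π))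
                     (subst (λ s → + 1 ℤ.≤ 0ℤ ℤ.+ judgeWeight pick s) (sym P[1]) ℤP.≤-refl)
    EL≥1 (suc d) = subst (ℤ._≤ EL judgeGame (path π) (suc (suc d))) (ℤP.+-identityʳ (+ 1))
      (ℤP.+-mono-≤ (EL≥1 d)
        (judgeWeight-nonneg (path π (suc d)) (path π (suc (suc d))) (never-sink (suc d))))

  punishIdle-beats : ¬ Objective judgeGame (+ 1 / 2) π
  punishIdle-beats (lb , ae)
    with after-pick (path π 1) (subst (λ s → judgeEdge s (path π 1) ≡ true) (start π) (step π 0))
  ... | inj₁ P[1] = ¬AvgEnergy-½-of-EL≥1 judgeGame π (EL≥1 P[1]) ae
  ... | inj₂ P[1] = idle-breaks-LowerBound P[1] lb

punishIdle-wins : Wins₂ judgeGame pick (+ 1 / 2) punishIdle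
punishIdle-wins π cons = punishIdle-beats {π = π} cons

memoryless-consistent : ∀ {τ} → Memoryless judgeGame τ → (π : Play judgeGame pick) →
  (∀ i → path π i ≡ judge → path π (suc i) ≡ move τ judge []) → Consistent judgeGame τ π
memoryless-consistent {τ} memoryless π after-judge i owner≡P2 =
  trans (after-judge i P≡judge)
    (sym (trans (cong (λ s → move τ s (past judgeGame (path π) i)) P≡judge) (memoryless judge _ [] refl)))
  where
  P≡judge : path π i ≡ judge
  P≡judge = judge-only (path π i) owner≡P2

idleForever : Play judgeGame pick
idleForever = record { path = idling ; start = refl ; step = λ i → idleNext-edge (idling i) }
  where
  idling : ℕ → Fin 5
  idling zero    = pick
  idling (suc i) = idleNext (idling i)

idleForever-EL : ∀ i → EL judgeGame (path idleForever) i ≡ 0ℤ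
idleForever-EL zero    = refl
idleForever-EL (suc i) = cong₂ ℤ._+_ (idleForever-EL i) (weight-0 (path idleForever i))
  where
  weight-0 : ∀ s → judgeWeight s (idleNext s) ≡ 0ℤ
  weight-0 pick  = refl
  weight-0 gain  = refl
  weight-0 idle  = refl
  weight-0 judge = refl
  weight-0 sink  = refl

idleForever-wins : Objective judgeGame (+ 1 / 2) idleForever
idleForever-wins with Objective-of-0≤EL≤ judgeGame idleForever 0 (λ i → 0 , idleForever-EL i , z≤n)
... | lb , ae = lb , AvgEnergy-mono judgeGame idleForever (cross-≤⇒/≤ 0 1 0 1 z≤n) ae

gainThenSink : Play judgeGame pick
gainThenSink = record { path = gaining ; start = refl ; step = gaining-edge }
  where
  gaining : ℕ → Fin 5
  gaining zero                = pick
  gaining (suc zero)          = gain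
  gaining (suc (suc zero))    = judge
  gaining (suc (suc (suc _))) = sink
  gaining-edge : ∀ i → judgeEdge (gaining i) (gaining (suc i)) ≡ true
  gaining-edge zero                = refl
  gaining-edge (suc zero)          = refl
  gaining-edge (suc (suc zero))    = refl
  gaining-edge (suc (suc (suc _))) = refl

gainThenSink-EL : ∀ j → EL judgeGame (path gainThenSink) (3 + j) ≡ 0ℤ
gainThenSink-EL zero    = refl
gainThenSink-EL (suc j) = cong (ℤ._+ 0ℤ) (gainThenSink-EL j)

gainThenSink-cumEL : ∀ j → cumEL judgeGame (path gainThenSink) (3 + j) ≡ + 2
gainThenSink-cumEL zero    = refl
gainThenSink-cumEL (suc j) = cong₂ ℤ._+_ (gainThenSink-cumEL j) (gainThenSink-EL (suc j))

gainThenSink-wins : Objective judgeGame (+ 1 / 2) gainThenSink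
gainThenSink-wins =
  LowerBound-of-EL≥0 judgeGame gainThenSink EL≥0 , AvgEnergy-of-avgEL≤ judgeGame gainThenSink 3 avg≤
  where
  EL≥0 : ∀ k → 0ℤ ℤ.≤ EL judgeGame (path gainThenSink) k
  EL≥0 zero                = +≤+ z≤n
  EL≥0 (suc zero)          = +≤+ z≤n
  EL≥0 (suc (suc zero))    = +≤+ z≤n
  EL≥0 (suc (suc (suc j))) = subst (0ℤ ℤ.≤_) (sym (gainThenSink-EL j)) (+≤+ z≤n)
  avg≤ : ∀ m → 3 ≤ m → avgEL judgeGame (path gainThenSink) m ℚ.≤ + 1 / 2
  avg≤ (suc (suc (suc j))) _ = subst (λ z → z / suc (suc (suc (suc j))) ℚ.≤ + 1 / 2)
    (sym (gainThenSink-cumEL (suc j))) (cross-≤⇒/≤ 2 1 (suc (suc (suc j))) 1 (s≤s (s≤s (s≤s (s≤s z≤n)))))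
  avg≤ zero             ()
  avg≤ (suc zero)       (s≤s ())
  avg≤ (suc (suc zero)) (s≤s (s≤s ()))

memoryless-loses : ∀ τ → Memoryless judgeGame τ → ¬ Wins₂ judgeGame pick (+ 1 / 2) τ
memoryless-loses τ memoryless wins with move τ judge [] in judge↦ | valid τ judge [] refl
... | pick | _ = wins idleForever
  (memoryless-consistent {τ = τ} memoryless idleForever
    (λ i P≡judge → trans (cong idleNext P≡judge) (sym judge↦)))
  idleForever-wins
... | sink | _ = wins gainThenSink
  (memoryless-consistent {τ = τ} memoryless gainThenSink after-judge)
  gainThenSink-wins
  where
  after-judge : ∀ i → path gainThenSink i ≡ judge → path gainThenSink (suc i) ≡ move τ judge []
  after-judge (suc (suc zero)) _ = sym judge↦

lemma12 : (Σ ℕ λ n → Σ (ℕ → Game n) λ G → Σ (ℕ → Fin n) λ s → Σ (ℕ → ℚ) λ t →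
    (∀ U x y → edge (G U) x y ≡ true → ∣ weight (G U) x y ∣ ≤ U)
    × (∀ U → ∃ λ σ → Wins₁ (G U) (s U) (t U) σ)
    × (∀ m → ∃ λ U₀ → ∀ U → U₀ ≤ U → ∀ σ →
    Wins₁ (G U) (s U) (t U) σ → ¬ HasMemory (G U) σ m))
    ×
    (Σ ℕ λ n → Σ (Game n) λ G → Σ (Fin n) λ s → Σ ℚ λ t →
    (∃ λ τ → Wins₂ G s t τ)
    × (∀ τ → Memoryless G τ → ¬ Wins₂ G s t τ))
lemma12 =
    ( 2 , climbGame , (λ _ → home) , (λ U → + U / 1)
    , climbWeight-bounded
    , (λ U → climbThenExit U , climbThenExit-wins U)
    , λ m → suc m , λ U m<U σ wins → climb-needs-memory m<U σ wins )
  , ( 5 , judgeGame , pick , + 1 / 2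
    , (punishIdle , punishIdle-wins)
    , memoryless-loses )
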